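{- Let $p$ be any pattern in the symmetry class of one of the following 16 patterns: $(123,\{0,1,2\},\{0,1,2\})$, $(123,\{0,1,2\},\{0,1,3\})$, $(123,\{0,1,2\},\{0,2,3\})$, $(123,\{0,1,2\},\{1,2,3\})$, $(123,\{0,1,3\},\{0,1,3\})$, $(123,\{0,1,3\},\{0,2,3\})$, $(132,\{0,1,2\},\{0,1,2\})$, $(132,\{0,1,2\},\{0,1,3\})$, $(132,\{0,1,2\},\{0,2,3\})$, $(132,\{0,1,2\},\{1,2,3\})$, $(132,\{0,1,3\},\{0,1,3\})$, $(132,\{0,1,3\},\{0,2,3\})$, $(132,\{0,1,3\},\{1,2,3\})$, $(132,\{0,2,3\},\{0,2,3\})$, $(132,\{0,2,3\},\{1,2,3\})$, $(132,\{1,2,3\},\{1,2,3\})$. Then for all $n\ge3$, $a_n(p)=n!-(n-3)!$.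
   Context: A bi-vincular pattern of length $k$ is a triple $p=(\sigma,X,Y)$ with $\sigma$ a permutation of $[k]$ in one-line notation and $X,Y\subseteq\{0,1,\dots,k\}$. A permutation $\pi=\pi_1\cdots\pi_n$ of $[n]$ contains $p$ if there are indices $1\le i_1<\dots<i_k\le n$ such that $(\pi_{i_1},\dots,\pi_{i_k})$ is order-isomorphic to $\sigma$ and, writing $j_1<\dots<j_k$ for the set $\{\pi_{i_1},\dots,\pi_{i_k}\}$ in increasing order and setting $i_0=j_0=0$, $i_{k+1}=j_{k+1}=n+1$, we have $i_{x+1}=i_x+1$ for all $x\in X$ and $j_{y+1}=j_y+1$ for all $y\in Y$. Otherwise $\pi$ avoids $p$; $a_n(p)$ is the number of permutations of $[n]$ avoiding $p$. For $p=(\sigma,X,Y)$ of length $k$ define $p^{i}=(\sigma^{ -1},Y,X)$, $p^{r}=(\sigma^{r},\{k-x:x\in X\},Y)$, $p^{c}=(\sigma^{c},X,\{k-y:y\in Y\})$, with $\sigma^r_m=\sigma_{k+1-m}$ and $\sigma^c_m=k+1-\sigma_m$; the symmetry class of $p$ is the set of patterns obtained from $p$ by finite compositions of $i,r,c$. -}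

module Defs where

open import Data.Nat as ℕ using (ℕ; zero; suc; _∸_; _≤_)
open import Data.Nat.Properties using (_<?_)
open import Data.Fin as Fin using (Fin; toℕ; fromℕ<; opposite)
open import Data.Vec using (Vec; []; _∷_; lookup)
open import Data.List using (List; []; _∷_; length; map)
open import Data.List.Membership.Propositional using (_∈_)
open import Data.List.Relation.Unary.Unique.Propositional using (Unique)
open import Data.Product using (Σ; ∃; ∃-syntax; _×_)
open import Data.Sum using (_⊎_)
open import Relation.Nullary using (¬_; yes; no)
open import Relation.Binary.PropositionalEquality using (_≡_)

-- A permutation of [n] is stored 0-based in one-line notation:
-- π = (π₁ … πₙ) is the vector whose a-th entry (a : Fin n) is πₐ₊₁ − 1.
IsPerm : ∀ {n} → Vec (Fin n) n → Set
IsPerm {n} π = ∀ (a b : Fin n) → lookup π a ≡ lookup π b → a ≡ b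

-- bi-vincular pattern (σ, X, Y) of length k; σ stored 0-based like π.
record Pattern (k : ℕ) : Set where
  constructor pat
  field
    σ : Vec (Fin k) k
    X : List ℕ
    Y : List ℕ
open Pattern public

_⇔_ : Set → Set → Set
A ⇔ B = (A → B) × (B → A)

-- positions i₀ = 0, i_x = (1-based position of the x-th chosen entry), i_{k+1} = n+1
posN : ∀ {k n} → (Fin k → Fin n) → ℕ → ℕ
posN f zero = zero
posN {k} {n} f (suc x) with x <? k
... | yes h = suc (toℕ (f (fromℕ< h)))
... | no _  = suc n

-- JVal π σ f y m : "j_y = m", where j₀ = 0, j_{k+1} = n+1 and, for 1 ≤ y ≤ k,
-- j_y is the y-th smallest of the (1-based) values π_{i_1},…,π_{i_k}.
-- Since the occurrence is order-isomorphic to σ, the y-th smallest value is the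
-- one at the chosen position a with σ_a = y.
JVal : ∀ {k n} → Vec (Fin n) n → Vec (Fin k) k → (Fin k → Fin n) → ℕ → ℕ → Set
JVal π σ f zero m = m ≡ zero
JVal {k} {n} π σ f (suc y) m =
  (y ℕ.< k × ∃[ a ] (toℕ (lookup σ a) ≡ y × m ≡ suc (toℕ (lookup π (f a)))))
  ⊎ (k ≤ y × m ≡ suc n)

Contains : ∀ {k n} → Pattern k → Vec (Fin n) n → Set
Contains {k} {n} (pat σ X Y) π =
  ∃[ f ] ( (∀ (a b : Fin k) → a Fin.< b → f a Fin.< f b)
         × (∀ (a b : Fin k) → (lookup π (f a) Fin.< lookup π (f b)) ⇔ (lookup σ a Fin.< lookup σ b))
         × (∀ x → x ∈ X → posN f (suc x) ≡ suc (posN f x))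
         × (∀ y → y ∈ Y → ∀ m m' → JVal π σ f y m → JVal π σ f (suc y) m' → m' ≡ suc m) )

Avoids : ∀ {k n} → Pattern k → Vec (Fin n) n → Set
Avoids p π = ¬ Contains p π

CountIs : (n : ℕ) → (Vec (Fin n) n → Set) → ℕ → Set
CountIs n P m = ∃[ xs ] (length xs ≡ m × Unique xs × (∀ v → (v ∈ xs) ⇔ P v))

AvoidCount : ∀ {k} → Pattern k → ℕ → ℕ → Set
AvoidCount p n m = CountIs n (λ π → IsPerm π × Avoids p π) m

IsInverseOf : ∀ {k} → Vec (Fin k) k → Vec (Fin k) k → Set
IsInverseOf {k} τ σ = ∀ (a : Fin k) → lookup τ (lookup σ a) ≡ a

revV : ∀ {k} → Vec (Fin k) k → Vec (Fin k) k
revV {k} σ = Data.Vec.tabulate (λ m → lookup σ (opposite m))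
  where import Data.Vec

compV : ∀ {k} → Vec (Fin k) k → Vec (Fin k) k
compV σ = Data.Vec.map opposite σ
  where import Data.Vec

data SymClass {k : ℕ} (p : Pattern k) : Pattern k → Set where
  base : SymClass p p
  by-i : ∀ {σ X Y} τ → SymClass p (pat σ X Y) → IsInverseOf τ σ → SymClass p (pat τ Y X)
  by-r : ∀ {σ X Y} → SymClass p (pat σ X Y) → SymClass p (pat (revV σ) (map (k ∸_) X) Y)
  by-c : ∀ {σ X Y} → SymClass p (pat σ X Y) → SymClass p (pat (compV σ) X (map (k ∸_) Y))

s123 s132 : Vec (Fin 3) 3
s123 = Fin.zero ∷ Fin.suc Fin.zero ∷ Fin.suc (Fin.suc Fin.zero) ∷ []
s132 = Fin.zero ∷ Fin.suc (Fin.suc Fin.zero) ∷ Fin.suc Fin.zero ∷ []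

S012 S013 S023 S123 : List ℕ
S012 = 0 ∷ 1 ∷ 2 ∷ []
S013 = 0 ∷ 1 ∷ 3 ∷ []
S023 = 0 ∷ 2 ∷ 3 ∷ []
S123 = 1 ∷ 2 ∷ 3 ∷ []

basePatterns : List (Pattern 3)
basePatterns =
  pat s123 S012 S012 ∷ pat s123 S012 S013 ∷ pat s123 S012 S023 ∷ pat s123 S012 S123 ∷
  pat s123 S013 S013 ∷ pat s123 S013 S023 ∷
  pat s132 S012 S012 ∷ pat s132 S012 S013 ∷ pat s132 S012 S023 ∷ pat s132 S012 S123 ∷
  pat s132 S013 S013 ∷ pat s132 S013 S023 ∷ pat s132 S013 S123 ∷
  pat s132 S023 S023 ∷ pat s132 S023 S123 ∷ pat s132 S123 S123 ∷ []

module Submission where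

-- Every pattern (σ, X, Y) of the class has σ invertible and each of X, Y
-- equal to {0,1,2,3} with a single gap left out (its Shape); the symmetries i, r, c
-- preserve this.  For such a pattern, three of the four gaps of the index sequence
-- 0 = i₀ < i₁ < i₂ < i₃ < i₄ = n + 1 of an occurrence must be closed, which pins
-- i₁, i₂, i₃ down completely; likewise for the value sequence j₀ < … < j₄.  So π
-- contains p iff π takes three forced values at three forced positions.  These
-- permutations number (n − 3)!, and the avoiders are the other n! − (n − 3)!.

open import Defs
open import Data.Nat as ℕ using (ℕ; zero; suc; _+_; _*_; _∸_; _≤_; _<_; z≤n; s≤s; s≤s⁻¹; _!)
open import Data.Nat.Properties
  using ( ≤-refl; ≤-trans; m≤m+n; m≤n⇒m≤1+n; <-trans; <-irrefl; <-asym; n<1+n; +-monoˡ-<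
        ; +-suc; +-identityʳ; +-cancelˡ-≡; m+n∸m≡n; m∸n≤m; ∸-cancelˡ-≡; m∸[m∸n]≡n )
open import Data.Fin as Fin using (Fin; toℕ; zero; suc; opposite)
open import Data.Fin.Properties
  using ( 0≢1+n; suc-injective; toℕ-fromℕ<; toℕ-injective; toℕ<n; <-cmp; any?; all?
        ; opposite-prop; opposite-involutive )
open import Data.Vec using (Vec; []; _∷_; lookup)
open import Data.Vec.Properties using (∷-injective; lookup∘tabulate; lookup-map)
open import Data.List using (List; []; _∷_; length; map; filter; _++_; allFin; upTo)
open import Data.List.Properties using (length-++; length-map; length-tabulate)
open import Data.List.Membership.Propositional using (_∈_; _∉_)
open import Data.List.Membership.Propositional.Properties
  using (∈-allFin; ∈-upTo⁺; ∈-upTo⁻; ∈-filter⁺; ∈-filter⁻; ∈-map⁺; ∈-map⁻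
        ; ∈-++⁺ˡ; ∈-++⁺ʳ; ∈-++⁻)
open import Data.List.Membership.Propositional.Properties.WithK using (unique∧set⇒bag)
open import Data.List.Relation.Binary.BagAndSetEquality using (∼bag⇒↭)
open import Data.List.Relation.Binary.Permutation.Propositional.Properties using (↭-length)
open import Data.List.Relation.Unary.Any using (here; there)
open import Data.List.Relation.Unary.All using (All; []; _∷_)
import Data.List.Relation.Unary.All as All
open import Data.List.Relation.Unary.All.Properties using (¬Any⇒All¬)
open import Data.List.Relation.Unary.AllPairs using ([]; _∷_)
open import Data.List.Relation.Unary.Unique.Propositional using (Unique)
import Data.List.Relation.Unary.Unique.Propositional.Properties as Unique
open import Data.Unit using (⊤; tt)
open import Data.Empty using (⊥; ⊥-elim)
open import Data.Product using (∃-syntax; _×_; _,_; proj₁; proj₂)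
open import Data.Sum using (_⊎_; inj₁; inj₂)
open import Data.Maybe using (Maybe; just; nothing)
open import Data.Maybe.Properties using (just-injective)
open import Function using (_∘_; case_of_)
open import Function.Bundles using (mk⇔)
open import Relation.Nullary using (¬_; yes; no)
open import Relation.Nullary.Decidable using (¬?; map′)
open import Relation.Unary using (Decidable)
open import Relation.Binary using (tri<; tri≈; tri>)
open import Relation.Binary.PropositionalEquality
  using (_≡_; _≢_; refl; sym; trans; cong; cong₂; subst; subst₂; module ≡-Reasoning)
open ≡-Reasoning

Count : (A : Set) → (A → Set) → ℕ → Set
Count A P m = ∃[ xs ] (length xs ≡ m × Unique xs × (∀ v → (v ∈ xs) ⇔ P v))

module _ {A : Set} {P : A → Set} {m} (c : Count A P m) where

  elements : List A
  elements = proj₁ c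

  length-elements : length elements ≡ m
  length-elements = proj₁ (proj₂ c)

  distinct : Unique elements
  distinct = proj₁ (proj₂ (proj₂ c))

  ∈-elements : ∀ v → (v ∈ elements) ⇔ P v
  ∈-elements = proj₂ (proj₂ (proj₂ c))

module _ {A : Set} where

  count-resp : ∀ {P Q : A → Set} {m m'} → (∀ v → P v ⇔ Q v) → m ≡ m' →
               Count A P m → Count A Q m'
  count-resp P⇔Q refl (xs , len , u , mem) =
    xs , len , u , λ v → proj₁ (P⇔Q v) ∘ proj₁ (mem v) , proj₂ (mem v) ∘ proj₂ (P⇔Q v)

  unique-length : ∀ {xs ys : List A} → Unique xs → Unique ys →
                  (∀ z → (z ∈ xs) ⇔ (z ∈ ys)) → length xs ≡ length ys
  unique-length ux uy same =
    ↭-length (∼bag⇒↭ (unique∧set⇒bag ux uy (λ {z} → mk⇔ (proj₁ (same z)) (proj₂ (same z)))))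

  count-unique : ∀ {P : A → Set} {m m'} → Count A P m → Count A P m' → m ≡ m'
  count-unique (xs , refl , ux , memx) (ys , refl , uy , memy) =
    unique-length ux uy λ z → proj₂ (memy z) ∘ proj₁ (memx z) , proj₂ (memx z) ∘ proj₁ (memy z)

  count-single : (y : A) → Count A (_≡ y) 1
  count-single y = y ∷ [] , refl , [] ∷ [] , λ v → (λ { (here v≡y) → v≡y }) , here

  length-filter-split : ∀ {Q : A → Set} (Q? : Decidable Q) xs →
    length (filter Q? xs) + length (filter (¬? ∘ Q?) xs) ≡ length xs
  length-filter-split Q? [] = refl
  length-filter-split Q? (x ∷ xs) with Q? x
  ... | yes _ = cong suc (length-filter-split Q? xs)
  ... | no _  = trans (+-suc _ _) (cong suc (length-filter-split Q? xs))

  count-filter : ∀ {P Q : A → Set} {a} (Q? : Decidable Q) → (c : Count A P a) →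
                 Count A (λ v → P v × Q v) (length (filter Q? (elements c)))
  count-filter Q? (xs , _ , u , mem) =
    filter Q? xs , refl , Unique.filter⁺ Q? u ,
    λ v → (λ p → let (v∈ , q) = ∈-filter⁻ Q? p in proj₁ (mem v) v∈ , q) ,
          (λ { (pv , q) → ∈-filter⁺ Q? (proj₂ (mem v) pv) q })

  count-split : ∀ {P Q : A → Set} {a b} → Decidable Q → Count A P a →
                Count A (λ v → P v × Q v) b →
                ∃[ c ] (Count A (λ v → P v × ¬ Q v) c × b + c ≡ a)
  count-split {a = a} Q? cP@(xs , len , _) cPQ =
    length (filter (¬? ∘ Q?) xs) , count-filter (¬? ∘ Q?) cP ,
    trans (cong (_+ _) (count-unique cPQ (count-filter Q? cP)))
          (trans (length-filter-split Q? xs) len)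

count-all : ∀ n → Count (Fin n) (λ _ → ⊤) n
count-all n =
  allFin n , length-tabulate {n = n} (λ i → i) , Unique.allFin⁺ n , λ v → (λ _ → tt) , (λ _ → ∈-allFin v)

count-image : ∀ {A : Set} {r} (f : Fin r → A) → (∀ a b → f a ≡ f b → a ≡ b) →
              Count A (λ y → ∃[ i ] (f i ≡ y)) r
count-image {r = r} f f-inj =
  map f (allFin r) , trans (length-map f (allFin r)) (length-elements (count-all r)) ,
  Unique.map⁺ (f-inj _ _) (Unique.allFin⁺ r) ,
  λ y → (λ p → let (i , _ , e) = ∈-map⁻ f p in i , sym e) , (λ { (i , refl) → ∈-map⁺ f (∈-allFin i) })

count-fresh : ∀ n (F : List (Fin n)) → Unique F → ∃[ c ] (Count (Fin n) (_∉ F) c × length F + c ≡ n)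
count-fresh n F uF with count-split (_∈? F) (count-all n) (F , refl , uF , λ v → (λ v∈ → tt , v∈) , proj₂)
  where open import Data.List.Membership.DecPropositional (Fin._≟_ {n}) using (_∈?_)
... | c , count , sum = c , count-resp (λ _ → proj₂ , (tt ,_)) refl count , sum

count-complement : ∀ {A : Set} {P Q : A → Set} {a b} → Decidable Q → Count A P a →
                   Count A (λ v → P v × Q v) b → Count A (λ v → P v × ¬ Q v) (a ∸ b)
count-complement {b = b} Q? cP cPQ with count-split Q? cP cPQ
... | c , count , sum = subst (Count _ _) (trans (sym (m+n∸m≡n b c)) (cong (_∸ b) sum)) count

HeadTail : ∀ {A : Set} {k} → (A → Set) → (A → Vec A k → Set) → Vec A (suc k) → Set
HeadTail H R (x ∷ r) = H x × R x r

module ProductRule {A : Set} {k c : ℕ} (R : A → Vec A k → Set) where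

  Tails : List A → Set
  Tails hs = ∀ h → h ∈ hs → Count (Vec A k) (R h) c

  extensions : (hs : List A) → Tails hs → List (Vec A (suc k))
  extensions []       tails = []
  extensions (h ∷ hs) tails =
    map (h ∷_) (elements (tails h (here refl))) ++ extensions hs (λ x → tails x ∘ there)

  length-extensions : ∀ hs tails → length (extensions hs tails) ≡ length hs * c
  length-extensions []       tails = refl
  length-extensions (h ∷ hs) tails =
    trans (length-++ (map (h ∷_) rs))
          (cong₂ _+_ (trans (length-map (h ∷_) rs) (length-elements (tails h (here refl))))
                     (length-extensions hs _))
    where
    rs : List (Vec A k)
    rs = elements (tails h (here refl))

  ∈-extensions⁻ : ∀ hs tails {x r} → (x ∷ r) ∈ extensions hs tails → x ∈ hs × R x r
  ∈-extensions⁻ (h ∷ hs) tails p with ∈-++⁻ (map (h ∷_) (elements (tails h (here refl)))) p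
  ... | inj₂ q = let (x∈ , rr) = ∈-extensions⁻ hs _ q in there x∈ , rr
  ... | inj₁ q with ∈-map⁻ (h ∷_) q
  ...   | r , r∈ , e with ∷-injective e
  ...     | refl , refl = here refl , proj₁ (∈-elements (tails h (here refl)) r) r∈

  ∈-extensions⁺ : ∀ hs tails {x r} → x ∈ hs → R x r → (x ∷ r) ∈ extensions hs tails
  ∈-extensions⁺ (h ∷ hs) tails (here refl) rr =
    ∈-++⁺ˡ (∈-map⁺ (h ∷_) (proj₂ (∈-elements (tails h (here refl)) _) rr))
  ∈-extensions⁺ (h ∷ hs) tails (there p) rr =
    ∈-++⁺ʳ (map (h ∷_) (elements (tails h (here refl)))) (∈-extensions⁺ hs _ p rr)

  unique-extensions : ∀ hs tails → Unique hs → Unique (extensions hs tails)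
  unique-extensions []       tails _          = []
  unique-extensions (h ∷ hs) tails (h∉ ∷ uhs) =
    Unique.++⁺ (Unique.map⁺ (proj₂ ∘ ∷-injective) (distinct (tails h (here refl))))
               (unique-extensions hs _ uhs)
               (λ { (p , q) → disjoint p q })
    where
    disjoint : ∀ {v} → v ∈ map (h ∷_) (elements (tails h (here refl))) →
               v ∈ extensions hs (λ x → tails x ∘ there) → ⊥
    disjoint p q with ∈-map⁻ (h ∷_) p
    ... | _ , _ , refl = All.lookup h∉ (proj₁ (∈-extensions⁻ hs _ q)) refl

  count-headTail : ∀ {H : A → Set} {a} → Count A H a → (∀ x → H x → Count (Vec A k) (R x) c) →
                   Count (Vec A (suc k)) (HeadTail H R) (a * c)
  count-headTail (hs , refl , uhs , mem) tails =
    extensions hs tails′ , length-extensions hs tails′ , unique-extensions hs tails′ uhs ,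
    λ { (x ∷ r) → (λ p → let (x∈ , rr) = ∈-extensions⁻ hs tails′ p in proj₁ (mem x) x∈ , rr) ,
                  (λ { (hx , rr) → ∈-extensions⁺ hs tails′ (proj₂ (mem x) hx) rr }) }
    where
    tails′ : Tails hs
    tails′ x = tails x ∘ proj₁ (mem x)

InjectiveVec : ∀ {A : Set} {k} → Vec A k → Set
InjectiveVec {k = k} v = ∀ (a b : Fin k) → lookup v a ≡ lookup v b → a ≡ b

module _ {A : Set} {k} {x : A} {r : Vec A k} where

  injective-∷⁺ : (∀ b → lookup r b ≢ x) → InjectiveVec r → InjectiveVec (x ∷ r)
  injective-∷⁺ fresh inj zero    zero    _ = refl
  injective-∷⁺ fresh inj zero    (suc b) e = ⊥-elim (fresh b (sym e))
  injective-∷⁺ fresh inj (suc a) zero    e = ⊥-elim (fresh a e)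
  injective-∷⁺ fresh inj (suc a) (suc b) e = cong suc (inj a b e)

  injective-∷⁻ : InjectiveVec (x ∷ r) → (∀ b → lookup r b ≢ x) × InjectiveVec r
  injective-∷⁻ inj = (λ b e → 0≢1+n (sym (inj (suc b) zero e))) ,
                     (λ a b e → suc-injective (inj (suc a) (suc b) e))

-- The constraint on one entry: a prescribed value, or (nothing) any value
-- outside the list F of values that are already taken.
Fits : ∀ {n} → Maybe (Fin n) → List (Fin n) → Fin n → Set
Fits nothing  F z = z ∉ F
Fits (just y) F z = z ≡ y

Completes : ∀ {n k} → (Fin k → Maybe (Fin n)) → List (Fin n) → Vec (Fin n) k → Set
Completes spec F v = InjectiveVec v × (∀ j → Fits (spec j) F (lookup v j))

isFree : ∀ {A : Set} → Maybe A → ℕ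
isFree nothing  = 1
isFree (just _) = 0

freeCount : ∀ {A : Set} {k} → (Fin k → Maybe A) → ℕ
freeCount {k = zero}  spec = 0
freeCount {k = suc k} spec = isFree (spec zero) + freeCount (spec ∘ suc)

module _ {k} {L : List (Fin k)} where

  zero∉map-suc : Fin.zero ∉ map Fin.suc L
  zero∉map-suc p with ∈-map⁻ suc p
  ... | _ , _ , ()

  ∈-map-suc : ∀ {j} → (Fin.suc j ∈ map Fin.suc L) ⇔ (j ∈ L)
  ∈-map-suc = (λ p → let (_ , j′∈ , e) = ∈-map⁻ suc p in subst (_∈ L) (sym (suc-injective e)) j′∈) ,
              ∈-map⁺ suc

count-free : ∀ {A : Set} {k} (spec : Fin k → Maybe A) → Count (Fin k) (λ j → spec j ≡ nothing) (freeCount spec)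
count-free {k = zero} spec = [] , refl , [] , λ ()
count-free {k = suc k} spec with count-free (spec ∘ suc) | spec zero in first
... | L , len , u , mem | nothing =
  zero ∷ map suc L , cong suc (trans (length-map suc L) len) ,
  ¬Any⇒All¬ _ zero∉map-suc ∷ Unique.map⁺ suc-injective u ,
  λ { zero    → (λ _ → first) , (λ _ → here refl)
    ; (suc j) → (λ { (there p) → proj₁ (mem j) (proj₁ ∈-map-suc p) }) ,
                there ∘ proj₂ ∈-map-suc ∘ proj₂ (mem j) }
... | L , len , u , mem | just _ =
  map suc L , trans (length-map suc L) len , Unique.map⁺ suc-injective u ,
  λ { zero    → ⊥-elim ∘ zero∉map-suc , λ e → case trans (sym first) e of λ ()
    ; (suc j) → proj₁ (mem j) ∘ proj₁ ∈-map-suc , proj₂ ∈-map-suc ∘ proj₂ (mem j) }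

record Admissible {n k} (spec : Fin k → Maybe (Fin n)) (F : List (Fin n)) : Set where
  field
    unique     : Unique F
    prescribed : ∀ j y → spec j ≡ just y → y ∈ F
    once       : ∀ j j' y → spec j ≡ just y → spec j' ≡ just y → j ≡ j'
    size       : length F + freeCount spec ≡ n

module Step {n k} {spec : Fin (suc k) → Maybe (Fin n)} {F : List (Fin n)} (adm : Admissible spec F) where
  open Admissible adm

  rest : Fin k → Maybe (Fin n)
  rest = spec ∘ suc

  fits-weaken : ∀ o {x z} → Fits o F z → z ≢ x → Fits o (x ∷ F) z
  fits-weaken nothing  z∉ z≢x (here z≡x) = z≢x z≡x
  fits-weaken nothing  z∉ z≢x (there z∈) = z∉ z∈
  fits-weaken (just y) z≡y _ = z≡y

  fits-strengthen : ∀ o {x z} → Fits o (x ∷ F) z → Fits o F z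
  fits-strengthen nothing  z∉ = z∉ ∘ there
  fits-strengthen (just y) z≡y = z≡y

  fits-avoids-fresh : ∀ j {x z} → Fits (spec j) (x ∷ F) z → x ∉ F → z ≢ x
  fits-avoids-fresh j fits x∉ z≡x with spec j in e
  ... | nothing = fits (here z≡x)
  ... | just y  = x∉ (subst (_∈ F) (trans (sym fits) z≡x) (prescribed j y e))

  fits-avoids-first : ∀ {y} → spec zero ≡ just y → ∀ j {z} → Fits (spec (suc j)) F z → z ≢ y
  fits-avoids-first {y} first j fits z≡y with spec (suc j) in e
  ... | nothing = fits (subst (_∈ F) (sym z≡y) (prescribed zero y first))
  ... | just y′ with once (suc j) zero y (trans e (cong just (trans (sym fits) z≡y))) first
  ...   | ()

  completes-free : spec zero ≡ nothing → ∀ v →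
    HeadTail (_∉ F) (λ x → Completes rest (x ∷ F)) v ⇔ Completes spec F v
  completes-free first (x ∷ r) = to , from
    where
    to : HeadTail (_∉ F) (λ x → Completes rest (x ∷ F)) (x ∷ r) → Completes spec F (x ∷ r)
    to (x∉ , injr , fitsr) =
      injective-∷⁺ (λ b → fits-avoids-fresh (suc b) (fitsr b) x∉) injr ,
      λ { zero → subst (λ o → Fits o F x) (sym first) x∉
        ; (suc j) → fits-strengthen (rest j) (fitsr j) }
    from : Completes spec F (x ∷ r) → HeadTail (_∉ F) (λ x → Completes rest (x ∷ F)) (x ∷ r)
    from (inj , fits) =
      let (fresh , injr) = injective-∷⁻ inj in
      subst (λ o → Fits o F x) first (fits zero) , injr ,
      λ j → fits-weaken (rest j) (fits (suc j)) (fresh j)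

  completes-fixed : ∀ {y} → spec zero ≡ just y → ∀ v →
    HeadTail (_≡ y) (λ _ → Completes rest F) v ⇔ Completes spec F v
  completes-fixed {y} first (x ∷ r) = to , from
    where
    to : HeadTail (_≡ y) (λ _ → Completes rest F) (x ∷ r) → Completes spec F (x ∷ r)
    to (refl , injr , fitsr) =
      injective-∷⁺ (λ b → fits-avoids-first first b (fitsr b)) injr ,
      λ { zero → subst (λ o → Fits o F x) (sym first) refl ; (suc j) → fitsr j }
    from : Completes spec F (x ∷ r) → HeadTail (_≡ y) (λ _ → Completes rest F) (x ∷ r)
    from (inj , fits) = subst (λ o → Fits o F x) first (fits zero) , proj₂ (injective-∷⁻ inj) , fits ∘ suc

  freeCount-free : spec zero ≡ nothing → freeCount spec ≡ suc (freeCount rest)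
  freeCount-free first = cong (λ o → isFree o + freeCount rest) first

  freeCount-fixed : ∀ {y} → spec zero ≡ just y → freeCount spec ≡ freeCount rest
  freeCount-fixed first = cong (λ o → isFree o + freeCount rest) first

  admissible-free : spec zero ≡ nothing → ∀ {x} → x ∉ F → Admissible rest (x ∷ F)
  admissible-free first x∉ = record
    { unique     = ¬Any⇒All¬ F x∉ ∷ unique
    ; prescribed = λ j y e → there (prescribed (suc j) y e)
    ; once       = λ j j′ y e e′ → suc-injective (once (suc j) (suc j′) y e e′)
    ; size       = trans (sym (+-suc (length F) _)) (trans (cong (length F +_) (sym (freeCount-free first))) size)
    }

  admissible-fixed : ∀ {y} → spec zero ≡ just y → Admissible rest F
  admissible-fixed first = record
    { unique     = unique
    ; prescribed = λ j → prescribed (suc j)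
    ; once       = λ j j′ y e e′ → suc-injective (once (suc j) (suc j′) y e e′)
    ; size       = trans (cong (length F +_) (sym (freeCount-fixed first))) size
    }

-- Induction on the length: position zero is either free, with n − |F| = 1 + (free
-- positions of the rest) fresh choices, or prescribed, with exactly one choice.
count-completions : ∀ {n k} (spec : Fin k → Maybe (Fin n)) (F : List (Fin n)) → Admissible spec F →
                    Count (Vec (Fin n) k) (Completes spec F) (freeCount spec !)
count-completions {k = zero} spec F adm =
  [] ∷ [] , refl , [] ∷ [] , λ { [] → (λ _ → (λ ()) , (λ ())) , (λ _ → here refl) }
count-completions {n} {suc k} spec F adm with spec zero in first
... | nothing = count-resp (completes-free first) refl
      (ProductRule.count-headTail _ heads
        λ x x∉ → count-completions rest (x ∷ F) (admissible-free first x∉))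
  where
  open Step adm
  heads : Count (Fin n) (_∉ F) (suc (freeCount rest))
  heads with count-fresh n F (Admissible.unique adm)
  ... | c , count , sum = subst (Count (Fin n) (_∉ F)) c≡ count
    where
    c≡ : c ≡ suc (freeCount rest)
    c≡ = +-cancelˡ-≡ (length F) _ _
           (trans sum (sym (trans (cong (length F +_) (sym (freeCount-free first))) (Admissible.size adm))))
... | just y = count-resp (completes-fixed first) (+-identityʳ _)
      (ProductRule.count-headTail _ (count-single y) λ _ _ → count-completions rest F (admissible-fixed first))
  where open Step adm

-- Permutations of [n] with r prescribed entries π(pos i) = val i, for injective
-- pos and val, number (n − r)!: they are the completions of the partial
-- assignment sending pos i to val i, whose free positions number n − r.
module Prescribed {n r} (pos val : Fin r → Fin n)
  (pos-inj : ∀ a b → pos a ≡ pos b → a ≡ b) (val-inj : ∀ a b → val a ≡ val b → a ≡ b) where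

  spec : Fin n → Maybe (Fin n)
  spec j with any? (λ i → pos i Fin.≟ j)
  ... | yes (i , _) = just (val i)
  ... | no _        = nothing

  spec-view : ∀ j → (∃[ i ] (pos i ≡ j × spec j ≡ just (val i)))
                  ⊎ ((∀ i → pos i ≢ j) × spec j ≡ nothing)
  spec-view j with any? (λ i → pos i Fin.≟ j)
  ... | yes (i , e) = inj₁ (i , e , refl)
  ... | no ne       = inj₂ ((λ i e → ne (i , e)) , refl)

  spec-pos : ∀ i → spec (pos i) ≡ just (val i)
  spec-pos i with spec-view (pos i)
  ... | inj₁ (i′ , e , s) rewrite pos-inj i′ i e = s
  ... | inj₂ (ne , _) = ⊥-elim (ne i refl)

  values-count : Count (Fin n) (λ y → ∃[ i ] (val i ≡ y)) r
  values-count = count-image val val-inj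

  values : List (Fin n)
  values = elements values-count

  ∈-values : ∀ y → (y ∈ values) ⇔ (∃[ i ] (val i ≡ y))
  ∈-values = ∈-elements values-count

  free+r : r + freeCount spec ≡ n
  free+r with count-split (λ j → any? (λ i → pos i Fin.≟ j)) (count-all n)
                (count-resp (λ _ → (tt ,_) , proj₂) refl (count-image pos pos-inj))
  ... | c , count , sum = trans (cong (r +_) (count-unique (count-free spec) (count-resp free⇔ refl count))) sum
    where
    free⇔ : ∀ j → (⊤ × ¬ (∃[ i ] (pos i ≡ j))) ⇔ (spec j ≡ nothing)
    free⇔ j with spec-view j
    ... | inj₁ (i , e , s) = (λ { (_ , ne) → ⊥-elim (ne (i , e)) }) , (λ s′ → case trans (sym s′) s of λ ())
    ... | inj₂ (ne , s) = (λ _ → s) , (λ _ → tt , λ { (i , e) → ne i e })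

  admissible : Admissible spec values
  admissible = record
    { unique     = distinct values-count
    ; prescribed = prescribed
    ; once       = once
    ; size       = trans (cong (_+ freeCount spec) (length-elements values-count)) free+r
    }
    where
    prescribed : ∀ j y → spec j ≡ just y → y ∈ values
    prescribed j y e with spec-view j
    ... | inj₁ (i , _ , s) = proj₂ (∈-values y) (i , just-injective (trans (sym s) e))
    ... | inj₂ (_ , s) = case trans (sym s) e of λ ()
    once : ∀ j j′ y → spec j ≡ just y → spec j′ ≡ just y → j ≡ j′
    once j j′ y e e′ with spec-view j | spec-view j′
    ... | inj₁ (i , refl , s) | inj₁ (i′ , refl , s′) =
      cong pos (val-inj i i′ (just-injective (trans (sym s) (trans e (trans (sym e′) s′)))))
    ... | inj₂ (_ , s) | _ = case trans (sym s) e of λ ()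
    ... | inj₁ _ | inj₂ (_ , s′) = case trans (sym s′) e′ of λ ()

  completes⇔prescribed : ∀ π → Completes spec values π ⇔ (IsPerm π × (∀ i → lookup π (pos i) ≡ val i))
  completes⇔prescribed π = to , from
    where
    to : Completes spec values π → IsPerm π × (∀ i → lookup π (pos i) ≡ val i)
    to (inj , fits) = inj , λ i → subst (λ o → Fits o values (lookup π (pos i))) (spec-pos i) (fits (pos i))
    from : IsPerm π × (∀ i → lookup π (pos i) ≡ val i) → Completes spec values π
    from (inj , match) = inj , fits
      where
      fits : ∀ j → Fits (spec j) values (lookup π j)
      fits j with spec-view j
      ... | inj₁ (i , refl , s) = subst (λ o → Fits o values (lookup π j)) (sym s) (match i)
      ... | inj₂ (ne , s) = subst (λ o → Fits o values (lookup π j)) (sym s)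
              λ p → let (i , e) = proj₁ (∈-values _) p in ne i (inj (pos i) j (trans (match i) e))

  count-prescribed : Count (Vec (Fin n) n) (λ π → IsPerm π × (∀ i → lookup π (pos i) ≡ val i)) ((n ∸ r) !)
  count-prescribed = count-resp completes⇔prescribed (cong _! (sym n∸r≡free))
                       (count-completions spec values admissible)
    where
    n∸r≡free : n ∸ r ≡ freeCount spec
    n∸r≡free = trans (cong (_∸ r) (sym free+r)) (m+n∸m≡n r _)

count-perms : ∀ n → Count (Vec (Fin n) n) IsPerm (n !)
count-perms n = count-resp (λ _ → proj₁ , (_, λ ())) refl
                           (Prescribed.count-prescribed {n} {0} (λ ()) (λ ()) (λ ()) (λ ()))

Omits : ∀ k → List ℕ → Fin (suc k) → Set
Omits k L d = ∀ x → (x ∈ L) ⇔ (x ≤ k × x ≢ toℕ d)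

allBut : ∀ k → Fin (suc k) → List ℕ
allBut k d = filter (λ x → ¬? (x ℕ.≟ toℕ d)) (upTo (suc k))

omits-allBut : ∀ k d → Omits k (allBut k d) d
omits-allBut k d x =
  (λ p → let (x∈ , x≢d) = ∈-filter⁻ (λ x → ¬? (x ℕ.≟ toℕ d)) p in
         s≤s⁻¹ (∈-upTo⁻ x∈) , x≢d) ,
  (λ { (x≤k , x≢d) → ∈-filter⁺ (λ x → ¬? (x ℕ.≟ toℕ d)) (∈-upTo⁺ (s≤s x≤k)) x≢d })

omits-reflect : ∀ {k L d} → Omits k L d → Omits k (map (k ∸_) L) (opposite d)
omits-reflect {k} {L} {d} omits x = to , from
  where
  d≤k : toℕ d ≤ k
  d≤k = s≤s⁻¹ (toℕ<n d)
  to : x ∈ map (k ∸_) L → x ≤ k × x ≢ toℕ (opposite d)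
  to p with ∈-map⁻ (k ∸_) p
  ... | z , z∈ , refl = let (z≤k , z≢d) = proj₁ (omits z) z∈ in
        m∸n≤m k z , λ e → z≢d (∸-cancelˡ-≡ z≤k d≤k (trans e (opposite-prop d)))
  from : x ≤ k × x ≢ toℕ (opposite d) → x ∈ map (k ∸_) L
  from (x≤k , x≢d′) =
    subst (_∈ map (k ∸_) L) (m∸[m∸n]≡n x≤k)
      (∈-map⁺ (k ∸_) (proj₂ (omits (k ∸ x)) (m∸n≤m k x , λ e → x≢d′ (x≡d′ e))))
    where
    x≡d′ : k ∸ x ≡ toℕ d → x ≡ toℕ (opposite d)
    x≡d′ e = trans (sym (m∸[m∸n]≡n x≤k)) (trans (cong (k ∸_) e) (sym (opposite-prop d)))

record Shape {k} (p : Pattern k) : Set where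
  field
    σ⁻¹    : Fin k → Fin k
    σ∘σ⁻¹  : ∀ y → lookup (σ p) (σ⁻¹ y) ≡ y
    σ⁻¹∘σ  : ∀ a → σ⁻¹ (lookup (σ p) a) ≡ a
    dX dY  : Fin (suc k)
    omitsX : Omits k (X p) dX
    omitsY : Omits k (Y p) dY

shape-closed : ∀ {k} {q p : Pattern k} → SymClass q p → Shape q → Shape p
shape-closed base sh = sh
shape-closed (by-i {σ} τ cls τ∘σ) sh = record
  { σ⁻¹ = lookup σ ; σ∘σ⁻¹ = τ∘σ ; σ⁻¹∘σ = σ∘τ
  ; dX = dY ; dY = dX ; omitsX = omitsY ; omitsY = omitsX }
  where
  open Shape (shape-closed cls sh)
  -- a left inverse τ of the bijection σ is also a right inverse
  σ∘τ : ∀ y → lookup σ (lookup τ y) ≡ y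
  σ∘τ y = begin
    lookup σ (lookup τ y)                    ≡⟨ cong (lookup σ ∘ lookup τ) (σ∘σ⁻¹ y) ⟨
    lookup σ (lookup τ (lookup σ (σ⁻¹ y)))   ≡⟨ cong (lookup σ) (τ∘σ (σ⁻¹ y)) ⟩
    lookup σ (σ⁻¹ y)                         ≡⟨ σ∘σ⁻¹ y ⟩
    y                                        ∎
shape-closed (by-r {σ} cls) sh = record
  { σ⁻¹ = opposite ∘ σ⁻¹ ; σ∘σ⁻¹ = σr∘σ⁻¹ ; σ⁻¹∘σ = σ⁻¹∘σr
  ; dX = opposite dX ; dY = dY ; omitsX = omits-reflect omitsX ; omitsY = omitsY }
  where
  open Shape (shape-closed cls sh)
  σr∘σ⁻¹ : ∀ y → lookup (revV σ) (opposite (σ⁻¹ y)) ≡ y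
  σr∘σ⁻¹ y = trans (lookup∘tabulate (lookup σ ∘ opposite) (opposite (σ⁻¹ y)))
                   (trans (cong (lookup σ) (opposite-involutive (σ⁻¹ y))) (σ∘σ⁻¹ y))
  σ⁻¹∘σr : ∀ a → opposite (σ⁻¹ (lookup (revV σ) a)) ≡ a
  σ⁻¹∘σr a = trans (cong (opposite ∘ σ⁻¹) (lookup∘tabulate (lookup σ ∘ opposite) a))
                   (trans (cong opposite (σ⁻¹∘σ (opposite a))) (opposite-involutive a))
shape-closed (by-c {σ} cls) sh = record
  { σ⁻¹ = σ⁻¹ ∘ opposite ; σ∘σ⁻¹ = σc∘σ⁻¹ ; σ⁻¹∘σ = σ⁻¹∘σc
  ; dX = dX ; dY = opposite dY ; omitsX = omitsX ; omitsY = omits-reflect omitsY }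
  where
  open Shape (shape-closed cls sh)
  σc∘σ⁻¹ : ∀ y → lookup (compV σ) (σ⁻¹ (opposite y)) ≡ y
  σc∘σ⁻¹ y = trans (lookup-map (σ⁻¹ (opposite y)) opposite σ)
                   (trans (cong opposite (σ∘σ⁻¹ (opposite y))) (opposite-involutive y))
  σ⁻¹∘σc : ∀ a → σ⁻¹ (opposite (lookup (compV σ) a)) ≡ a
  σ⁻¹∘σc a = trans (cong (σ⁻¹ ∘ opposite) (lookup-map a opposite σ))
                   (trans (cong σ⁻¹ (opposite-involutive (lookup σ a))) (σ⁻¹∘σ a))

pattern 0F = zero
pattern 1F = suc zero
pattern 2F = suc (suc zero)
pattern 3F = suc (suc (suc zero))

-- The sixteen base patterns have this shape: 123 and 132 are involutions, and
-- the gap lists S012, S013, S023, S123 are allBut 3 d for d = 3, 2, 1, 0.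
involution-shape : ∀ {σ} dX dY → (∀ a → lookup σ (lookup σ a) ≡ a) → Shape (pat σ (allBut 3 dX) (allBut 3 dY))
involution-shape {σ} dX dY invol = record
  { σ⁻¹ = lookup σ ; σ∘σ⁻¹ = invol ; σ⁻¹∘σ = invol
  ; dX = dX ; dY = dY ; omitsX = omits-allBut 3 dX ; omitsY = omits-allBut 3 dY }

base-shapes : All Shape basePatterns
base-shapes =
  shape123 3F 3F ∷ shape123 3F 2F ∷ shape123 3F 1F ∷ shape123 3F 0F ∷ shape123 2F 2F ∷ shape123 2F 1F ∷
  shape132 3F 3F ∷ shape132 3F 2F ∷ shape132 3F 1F ∷ shape132 3F 0F ∷ shape132 2F 2F ∷ shape132 2F 1F ∷
  shape132 2F 0F ∷ shape132 1F 1F ∷ shape132 1F 0F ∷ shape132 0F 0F ∷ []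
  where
  shape123 : ∀ dX dY → Shape (pat s123 (allBut 3 dX) (allBut 3 dY))
  shape123 dX dY = involution-shape dX dY λ { 0F → refl ; 1F → refl ; 2F → refl }
  shape132 : ∀ dX dY → Shape (pat s132 (allBut 3 dX) (allBut 3 dY))
  shape132 dX dY = involution-shape dX dY λ { 0F → refl ; 1F → refl ; 2F → refl }

-- The extended sequence 0, 1 + g 0F, 1 + g 1F, 1 + g 2F, n + 1 of an increasing
-- triple g in [n] (0-based): the indices i₀ … i₄, resp. values j₀ … j₄, of an occurrence.
bracket : (Fin 3 → ℕ) → ℕ → ℕ → ℕ
bracket g n 0 = 0
bracket g n 1 = suc (g 0F)
bracket g n 2 = suc (g 1F)
bracket g n 3 = suc (g 2F)
bracket g n (suc (suc (suc (suc _)))) = suc n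

bracket-cong : ∀ {g g′} n → (∀ i → g i ≡ g′ i) → ∀ x → bracket g n x ≡ bracket g′ n x
bracket-cong n e 0 = refl
bracket-cong n e 1 = cong suc (e 0F)
bracket-cong n e 2 = cong suc (e 1F)
bracket-cong n e 3 = cong suc (e 2F)
bracket-cong n e (suc (suc (suc (suc _)))) = refl

Closed : Fin 4 → (Fin 3 → ℕ) → ℕ → Set
Closed d g n = ∀ x → x ≤ 3 → x ≢ toℕ d → bracket g n (suc x) ≡ suc (bracket g n x)

closed-resp : ∀ {d g g′ n} → (∀ i → g i ≡ g′ i) → Closed d g n → Closed d g′ n
closed-resp {n = n} e closed x x≤3 x≢d =
  trans (sym (bracket-cong n e (suc x))) (trans (closed x x≤3 x≢d) (cong suc (bracket-cong n e x)))

-- The forced triple in [3 + m]: entries before the open gap d sit at the start,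
-- the others at the end.
forced : Fin 4 → ℕ → Fin 3 → ℕ
forced 0F m i  = toℕ i + m
forced 1F m 0F = 0
forced 1F m i  = toℕ i + m
forced 2F m 2F = 2 + m
forced 2F m i  = toℕ i
forced 3F m i  = toℕ i

start : ∀ (i : Fin 3) m → toℕ i < 3 + m
start i m = ≤-trans (toℕ<n i) (m≤m+n 3 m)

shifted : ∀ (i : Fin 3) m → toℕ i + m < 3 + m
shifted i m = +-monoˡ-< m (toℕ<n i)

first : ∀ {a} → 1 + a ≡ 1 → a ≡ 0
first refl = refl

last : ∀ {a m} → 4 + m ≡ 2 + a → a ≡ 2 + m
last refl = refl

up : ∀ {a b c} → 1 + b ≡ 2 + a → a ≡ c → b ≡ 1 + c
up refl refl = refl

down : ∀ {a b c} → 1 + b ≡ 2 + a → b ≡ 1 + c → a ≡ c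
down refl refl = refl

≤1 : 1 ≤ 3
≤1 = s≤s z≤n

≤2 : 2 ≤ 3
≤2 = s≤s (s≤s z≤n)

≤3 : 3 ≤ 3
≤3 = s≤s (s≤s (s≤s z≤n))

forced-< : ∀ d m i → forced d m i < 3 + m
forced-< 0F m i       = shifted i m
forced-< 1F m 0F      = start 0F m
forced-< 1F m (suc i) = shifted (suc i) m
forced-< 2F m 0F      = start 0F m
forced-< 2F m 1F      = start 1F m
forced-< 2F m 2F      = shifted 2F m
forced-< 3F m i       = start i m

forced-closed : ∀ d m → Closed d (forced d m) (3 + m)
forced-closed 0F _ 0 _ gap-d = ⊥-elim (gap-d refl)
forced-closed 0F _ 1 _ _ = refl
forced-closed 0F _ 2 _ _ = refl
forced-closed 0F _ 3 _ _ = refl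
forced-closed 1F _ 0 _ _ = refl
forced-closed 1F _ 1 _ gap-d = ⊥-elim (gap-d refl)
forced-closed 1F _ 2 _ _ = refl
forced-closed 1F _ 3 _ _ = refl
forced-closed 2F _ 0 _ _ = refl
forced-closed 2F _ 1 _ _ = refl
forced-closed 2F _ 2 _ gap-d = ⊥-elim (gap-d refl)
forced-closed 2F _ 3 _ _ = refl
forced-closed 3F _ 0 _ _ = refl
forced-closed 3F _ 1 _ _ = refl
forced-closed 3F _ 2 _ _ = refl
forced-closed 3F _ 3 _ gap-d = ⊥-elim (gap-d refl)
forced-closed _  _ (suc (suc (suc (suc _)))) (s≤s (s≤s (s≤s ()))) _

-- Closing all gaps but one forces the triple: the closed gaps before d pin the
-- entries to 0, 1, …, those after d pin them to …, m + 1, m + 2.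
closed-forced : ∀ d m g → Closed d g (3 + m) → ∀ i → g i ≡ forced d m i
closed-forced 0F m g closed = λ { 0F → e0 ; 1F → e1 ; 2F → e2 }
  where
  e0 : g 0F ≡ m
  e1 : g 1F ≡ 1 + m
  e2 : g 2F ≡ 2 + m
  e2 = last (closed 3 ≤3 λ ())
  e1 = down (closed 2 ≤2 λ ()) e2
  e0 = down (closed 1 ≤1 λ ()) e1
closed-forced 1F m g closed = λ { 0F → e0 ; 1F → e1 ; 2F → e2 }
  where
  e0 : g 0F ≡ 0
  e1 : g 1F ≡ 1 + m
  e2 : g 2F ≡ 2 + m
  e0 = first (closed 0 z≤n λ ())
  e2 = last (closed 3 ≤3 λ ())
  e1 = down (closed 2 ≤2 λ ()) e2
closed-forced 2F m g closed = λ { 0F → e0 ; 1F → e1 ; 2F → e2 }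
  where
  e0 : g 0F ≡ 0
  e1 : g 1F ≡ 1
  e2 : g 2F ≡ 2 + m
  e0 = first (closed 0 z≤n λ ())
  e1 = up (closed 1 ≤1 λ ()) e0
  e2 = last (closed 3 ≤3 λ ())
closed-forced 3F m g closed = λ { 0F → e0 ; 1F → e1 ; 2F → e2 }
  where
  e0 : g 0F ≡ 0
  e1 : g 1F ≡ 1
  e2 : g 2F ≡ 2
  e0 = first (closed 0 z≤n λ ())
  e1 = up (closed 1 ≤1 λ ()) e0
  e2 = up (closed 2 ≤2 λ ()) e1

increasing3 : ∀ {t : Fin 3 → ℕ} → t 0F < t 1F → t 1F < t 2F → ∀ a b → a Fin.< b → t a < t b
increasing3 p q 0F 1F _ = p
increasing3 p q 0F 2F _ = <-trans p q
increasing3 p q 1F 2F _ = q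
increasing3 p q _  0F ()
increasing3 p q 1F 1F (s≤s ())
increasing3 p q 2F 1F (s≤s ())
increasing3 p q 2F 2F (s≤s (s≤s ()))

forced-increasing : ∀ d m a b → a Fin.< b → forced d m a < forced d m b
forced-increasing 0F m = increasing3 (n<1+n m) (n<1+n (1 + m))
forced-increasing 1F m = increasing3 (s≤s z≤n) (n<1+n (1 + m))
forced-increasing 2F m = increasing3 (s≤s z≤n) (s≤s (s≤s z≤n))
forced-increasing 3F m = increasing3 (s≤s z≤n) (s≤s (s≤s z≤n))

module StrictlyIncreasing {k} (t : Fin k → ℕ) (increasing : ∀ a b → a Fin.< b → t a < t b) where

  reflects : ∀ a b → t a < t b → a Fin.< b
  reflects a b lt with <-cmp a b
  ... | tri< a<b _ _ = a<b
  ... | tri≈ _ refl _ = ⊥-elim (<-irrefl refl lt)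
  ... | tri> _ _ b<a = ⊥-elim (<-asym lt (increasing b a b<a))

  injective : ∀ a b → t a ≡ t b → a ≡ b
  injective a b e with <-cmp a b
  ... | tri< a<b _ _ = ⊥-elim (<-irrefl e (increasing a b a<b))
  ... | tri≈ _ a≡b _ = a≡b
  ... | tri> _ _ b<a = ⊥-elim (<-irrefl (sym e) (increasing b a b<a))

module Occurrence {p : Pattern 3} (shape : Shape p) (m : ℕ) where
  open Shape shape

  n : ℕ
  n = 3 + m

  position rank value : Fin 3 → Fin n
  position i = Fin.fromℕ< (forced-< dX m i)
  rank y     = Fin.fromℕ< (forced-< dY m y)
  value i    = rank (lookup (σ p) i)

  toℕ-position : ∀ i → toℕ (position i) ≡ forced dX m i
  toℕ-position i = toℕ-fromℕ< (forced-< dX m i)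

  toℕ-rank : ∀ y → toℕ (rank y) ≡ forced dY m y
  toℕ-rank y = toℕ-fromℕ< (forced-< dY m y)

  position-increasing : ∀ a b → a Fin.< b → position a Fin.< position b
  position-increasing a b a<b =
    subst₂ _<_ (sym (toℕ-position a)) (sym (toℕ-position b)) (forced-increasing dX m a b a<b)

  rank-increasing : ∀ a b → a Fin.< b → rank a Fin.< rank b
  rank-increasing a b a<b =
    subst₂ _<_ (sym (toℕ-rank a)) (sym (toℕ-rank b)) (forced-increasing dY m a b a<b)

  module Position = StrictlyIncreasing (toℕ ∘ position) position-increasing
  module Rank     = StrictlyIncreasing (toℕ ∘ rank) rank-increasing

  position-injective : ∀ a b → position a ≡ position b → a ≡ b
  position-injective a b e = Position.injective a b (cong toℕ e)

  value-injective : ∀ a b → value a ≡ value b → a ≡ b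
  value-injective a b e = begin
    a                      ≡⟨ σ⁻¹∘σ a ⟨
    σ⁻¹ (lookup (σ p) a)   ≡⟨ cong σ⁻¹ (Rank.injective _ _ (cong toℕ e)) ⟩
    σ⁻¹ (lookup (σ p) b)   ≡⟨ σ⁻¹∘σ b ⟩
    b                      ∎

  Match : Vec (Fin n) n → Set
  Match π = ∀ i → lookup π (position i) ≡ value i

  at-rank : ∀ a y → toℕ (lookup (σ p) a) ≡ toℕ y → a ≡ σ⁻¹ y
  at-rank a y e = trans (sym (σ⁻¹∘σ a)) (cong σ⁻¹ (toℕ-injective e))

  match? : Decidable Match
  match? π = all? λ i → lookup π (position i) Fin.≟ value i

  posN-bracket : ∀ (f : Fin 3 → Fin n) x → x ≤ 4 → posN f x ≡ bracket (toℕ ∘ f) n x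
  posN-bracket f 0 _ = refl
  posN-bracket f 1 _ = refl
  posN-bracket f 2 _ = refl
  posN-bracket f 3 _ = refl
  posN-bracket f 4 _ = refl
  posN-bracket f (suc (suc (suc (suc (suc _))))) (s≤s (s≤s (s≤s (s≤s ()))))

  XGaps : (Fin 3 → Fin n) → Set
  XGaps f = ∀ x → x ∈ X p → posN f (suc x) ≡ suc (posN f x)

  xgaps⇔closed : ∀ f → XGaps f ⇔ Closed dX (toℕ ∘ f) n
  xgaps⇔closed f = to , from
    where
    at : ∀ {x} → x ≤ 3 → posN f x ≡ bracket (toℕ ∘ f) n x × posN f (suc x) ≡ bracket (toℕ ∘ f) n (suc x)
    at x≤3 = posN-bracket f _ (m≤n⇒m≤1+n x≤3) , posN-bracket f _ (s≤s x≤3)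
    to : XGaps f → Closed dX (toℕ ∘ f) n
    to xgaps x x≤3 x≢d = let (now , next) = at x≤3 in
      trans (sym next) (trans (xgaps x (proj₂ (omitsX x) (x≤3 , x≢d))) (cong suc now))
    from : Closed dX (toℕ ∘ f) n → XGaps f
    from closed x x∈ = let (x≤3 , x≢d) = proj₁ (omitsX x) x∈ ; (now , next) = at x≤3 in
      trans next (trans (closed x x≤3 x≢d) (cong suc (sym now)))

  -- sorted π f y: the (y+1)-th smallest of the values of π at f, 0-based; it
  -- sits at position σ⁻¹ y of the occurrence.
  sorted : Vec (Fin n) n → (Fin 3 → Fin n) → Fin 3 → ℕ
  sorted π f y = toℕ (lookup π (f (σ⁻¹ y)))

  jval-bracket : ∀ π f y → y ≤ 4 → JVal π (σ p) f y (bracket (sorted π f) n y)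
  jval-bracket π f 0 _ = refl
  jval-bracket π f 1 _ = inj₁ (s≤s z≤n , σ⁻¹ 0F , cong toℕ (σ∘σ⁻¹ 0F) , refl)
  jval-bracket π f 2 _ = inj₁ (s≤s (s≤s z≤n) , σ⁻¹ 1F , cong toℕ (σ∘σ⁻¹ 1F) , refl)
  jval-bracket π f 3 _ = inj₁ (s≤s (s≤s (s≤s z≤n)) , σ⁻¹ 2F , cong toℕ (σ∘σ⁻¹ 2F) , refl)
  jval-bracket π f 4 _ = inj₂ (≤-refl , refl)
  jval-bracket π f (suc (suc (suc (suc (suc _))))) (s≤s (s≤s (s≤s (s≤s ()))))

  entry : Vec (Fin n) n → (Fin 3 → Fin n) → Fin 3 → ℕ
  entry π f a = suc (toℕ (lookup π (f a)))

  jval-unique : ∀ π f y {r} → y ≤ 4 → JVal π (σ p) f y r → r ≡ bracket (sorted π f) n y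
  jval-unique π f 0 _ r≡0 = r≡0
  jval-unique π f 1 _ (inj₁ (_ , a , σa≡ , r≡)) = trans r≡ (cong (entry π f) (at-rank a 0F σa≡))
  jval-unique π f 2 _ (inj₁ (_ , a , σa≡ , r≡)) = trans r≡ (cong (entry π f) (at-rank a 1F σa≡))
  jval-unique π f 3 _ (inj₁ (_ , a , σa≡ , r≡)) = trans r≡ (cong (entry π f) (at-rank a 2F σa≡))
  jval-unique π f 4 _ (inj₁ (4<3 , _)) = ⊥-elim (<-irrefl refl 4<3)
  jval-unique π f 4 _ (inj₂ (_ , r≡)) = r≡
  jval-unique π f 1 _ (inj₂ (() , _))
  jval-unique π f 2 _ (inj₂ (s≤s () , _))
  jval-unique π f 3 _ (inj₂ (s≤s (s≤s ()) , _))
  jval-unique π f (suc (suc (suc (suc (suc _))))) (s≤s (s≤s (s≤s (s≤s ())))) _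

  YGaps : Vec (Fin n) n → (Fin 3 → Fin n) → Set
  YGaps π f = ∀ y → y ∈ Y p → ∀ r r′ →
              JVal π (σ p) f y r → JVal π (σ p) f (suc y) r′ → r′ ≡ suc r

  ygaps⇔closed : ∀ π f → YGaps π f ⇔ Closed dY (sorted π f) n
  ygaps⇔closed π f = to , from
    where
    to : YGaps π f → Closed dY (sorted π f) n
    to ygaps y y≤3 y≢d = ygaps y (proj₂ (omitsY y) (y≤3 , y≢d)) _ _
      (jval-bracket π f y (m≤n⇒m≤1+n y≤3)) (jval-bracket π f (suc y) (s≤s y≤3))
    from : Closed dY (sorted π f) n → YGaps π f
    from closed y y∈ r r′ jv jv′ = let (y≤3 , y≢d) = proj₁ (omitsY y) y∈ in
      trans (jval-unique π f (suc y) (s≤s y≤3) jv′)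
            (trans (closed y y≤3 y≢d) (cong suc (sym (jval-unique π f y (m≤n⇒m≤1+n y≤3) jv))))

  match→contains : ∀ π → Match π → Contains p π
  match→contains π match =
    position , position-increasing , order ,
    proj₂ (xgaps⇔closed position) (closed-resp (sym ∘ toℕ-position) (forced-closed dX m)) ,
    proj₂ (ygaps⇔closed π position) (closed-resp sorted-forced (forced-closed dY m))
    where
    order : ∀ a b → (lookup π (position a) Fin.< lookup π (position b)) ⇔ (lookup (σ p) a Fin.< lookup (σ p) b)
    order a b = (λ lt → Rank.reflects _ _ (subst₂ Fin._<_ (match a) (match b) lt)) ,
                (λ lt → subst₂ Fin._<_ (sym (match a)) (sym (match b)) (rank-increasing _ _ lt))
    sorted-forced : ∀ y → forced dY m y ≡ sorted π position y
    sorted-forced y = sym (begin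
      toℕ (lookup π (position (σ⁻¹ y)))   ≡⟨ cong toℕ (match (σ⁻¹ y)) ⟩
      toℕ (rank (lookup (σ p) (σ⁻¹ y)))   ≡⟨ cong (toℕ ∘ rank) (σ∘σ⁻¹ y) ⟩
      toℕ (rank y)                        ≡⟨ toℕ-rank y ⟩
      forced dY m y                       ∎)

  -- Every occurrence of p is the forced one: its gaps force both its positions
  -- and its sorted values.
  contains→match : ∀ π → Contains p π → Match π
  contains→match π (f , _ , _ , xgaps , ygaps) i = begin
    lookup π (position i)              ≡⟨ cong (lookup π) (f-forced i) ⟨
    lookup π (f i)                     ≡⟨ cong (lookup π ∘ f) (σ⁻¹∘σ i) ⟨
    lookup π (f (σ⁻¹ (lookup (σ p) i))) ≡⟨ sorted-forced (lookup (σ p) i) ⟩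
    value i                            ∎
    where
    f-forced : ∀ i → f i ≡ position i
    f-forced i = toℕ-injective
      (trans (closed-forced dX m (toℕ ∘ f) (proj₁ (xgaps⇔closed f) xgaps) i) (sym (toℕ-position i)))
    sorted-forced : ∀ y → lookup π (f (σ⁻¹ y)) ≡ rank y
    sorted-forced y = toℕ-injective
      (trans (closed-forced dY m (sorted π f) (proj₁ (ygaps⇔closed π f) ygaps) y) (sym (toℕ-rank y)))

  contains? : Decidable (Contains p)
  contains? π = map′ (match→contains π) (contains→match π) (match? π)

  count-containing : Count (Vec (Fin n) n) (λ π → IsPerm π × Contains p π) (m !)
  count-containing =
    count-resp (λ π → (λ { (perm , match) → perm , match→contains π match }) ,
                      (λ { (perm , occ) → perm , contains→match π occ }))
               refl
               (Prescribed.count-prescribed position value position-injective value-injective)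

-- p inherits the shape of its base pattern q; removing the (n − 3)! permutations
-- that contain p from all n! permutations leaves the avoiders.
mainTheorem19 : (p : Pattern 3) → ∃[ q ] (q ∈ basePatterns × SymClass q p) →
    (n : ℕ) → 3 ≤ n → AvoidCount p n (n ! ∸ (n ∸ 3) !)
mainTheorem19 p (q , q∈ , cls) (suc (suc (suc m))) (s≤s (s≤s (s≤s _))) =
  count-complement contains? (count-perms (3 + m)) count-containing
  where open Occurrence (shape-closed cls (All.lookup base-shapes q∈)) m
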